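{- Let $G$ be a finite $k$-regular graph. Let $f_1:V(G)\to\{1,-1,0\}$ be a function that is a linear combination of eigenfunctions of $G$ corresponding to non-principal eigenvalues (eigenvalues different from $k$), and let $Supp^+(f_1)$ and $Supp^-(f_1)$ be the sets of vertices where $f_1$ takes the values $1$ and $-1$, respectively. Let $\theta$ be a non-principal eigenvalue of $G$ such that none of the eigenfunctions used in the linear combination defining $f_1$ corresponds to $\theta$. Let $\Pi=(V_1,V_2)$ be any $\theta$-equitable $2$-partition of $G$. Then $$|Supp^+(f_1)\cap V_1| = |Supp^-(f_1)\cap V_1|.$$
   Context: A $\theta$-eigenfunction of $G$ is a real function $f\not\equiv 0$ on $V(G)$ with $\theta f(u)=\sum_{w\sim u} f(w)$ for all vertices $u$. A partition $\Pi=(V_1,V_2)$ of $V(G)$ is equitable if there are constants $p_{ij}$ such that every vertex of $V_i$ has exactly $p_{ij}$ neighbours in $V_j$ ($i,j\in\{1,2\}$); its quotient matrix $P_\Pi=(p_{ij})$ has eigenvalue $k$ and exactly one further eigenvalue $\theta=p_{11}-p_{21}$, which is a non-principal eigenvalue of $G$, and $\Pi$ is then called $\theta$-equitable. -}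

module Defs where

open import Level using (Level; _⊔_; suc)
open import Data.Bool using (Bool; true; false; if_then_else_)
open import Data.Nat as ℕ using (ℕ; zero)
open import Data.Integer as ℤ using (ℤ; +_; -[1+_])
open import Data.Fin using (Fin)
import Data.Fin
open import Data.Product using (Σ; ∃; _×_; _,_)
open import Data.Sum using (_⊎_)
open import Relation.Nullary using (¬_)
open import Relation.Binary.PropositionalEquality using (_≡_)
open import Relation.Binary.Structures using (IsTotalOrder)
open import Algebra.Bundles using (CommutativeRing)

-- The real numbers, axiomatised as a complete ordered field.
-- (agda-stdlib has no reals; every complete ordered field is
--  isomorphic to ℝ, so quantifying over such a structure is stating
--  the result for ℝ.)

record RealField (c ℓ : Level) : Set (suc (c ⊔ ℓ)) where
  field
    commRing : CommutativeRing c ℓ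
  open CommutativeRing commRing public
  field
    _≤_          : Carrier → Carrier → Set ℓ
    isTotalOrder : IsTotalOrder _≈_ _≤_
    +-mono-≤     : ∀ {x y} z → x ≤ y → (x + z) ≤ (y + z)
    *-nonneg     : ∀ {x y} → 0# ≤ x → 0# ≤ y → 0# ≤ (x * y)
    0≉1          : ¬ (0# ≈ 1#)
    inverse      : ∀ x → ¬ (x ≈ 0#) → ∃ λ y → (x * y) ≈ 1#
    sup          : (S : Carrier → Set ℓ) → ∃ S →
                   (∃ λ b → ∀ x → S x → x ≤ b) →
                   ∃ λ s → (∀ x → S x → x ≤ s) ×
                           (∀ b → (∀ x → S x → x ≤ b) → s ≤ b)

module _ {c ℓ : Level} (R : RealField c ℓ) where
  open RealField R

  sumR : ∀ n → (Fin n → Carrier) → Carrier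
  sumR zero f = 0#
  sumR (ℕ.suc n) f = f Data.Fin.zero + sumR n (λ i → f (Data.Fin.suc i))

  fromℕ : ℕ → Carrier
  fromℕ zero = 0#
  fromℕ (ℕ.suc n) = 1# + fromℕ n

  fromℤ : ℤ → Carrier
  fromℤ (+ n) = fromℕ n
  fromℤ -[1+ n ] = - fromℕ (ℕ.suc n)

record Graph (n : ℕ) : Set where
  field
    adj      : Fin n → Fin n → Bool
    sym      : ∀ u w → adj u w ≡ adj w u
    irrefl   : ∀ u → adj u u ≡ false

count : ∀ n → (Fin n → Bool) → ℕ
count zero p = zero
count (ℕ.suc n) p = (if p Data.Fin.zero then 1 else 0) ℕ.+ count n (λ i → p (Data.Fin.suc i))

module _ {n : ℕ} (G : Graph n) where
  open Graph G

  degree : Fin n → ℕ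
  degree u = count n (adj u)

  Regular : ℕ → Set
  Regular k = ∀ u → degree u ≡ k

  nbrsIn : Fin n → (Fin n → Bool) → ℕ
  nbrsIn u S = count n (λ w → if adj u w then S w else false)

module _ {c ℓ : Level} (R : RealField c ℓ) {n : ℕ} (G : Graph n) where
  open RealField R
  open Graph G

  nbrSum : (Fin n → Carrier) → Fin n → Carrier
  nbrSum f u = sumR R n (λ w → if adj u w then f w else 0#)

  IsEigenfunction : Carrier → (Fin n → Carrier) → Set ℓ
  IsEigenfunction θ f = (∃ λ u → ¬ (f u ≈ 0#)) × (∀ u → (θ * f u) ≈ nbrSum f u)

  IsEigenvalue : Carrier → Set (c ⊔ ℓ)
  IsEigenvalue θ = ∃ (IsEigenfunction θ)

  IsNonPrincipalEigenvalue : ℕ → Carrier → Set (c ⊔ ℓ)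
  IsNonPrincipalEigenvalue k θ = IsEigenvalue θ × ¬ (θ ≈ fromℕ R k)

  LinCombOfEigenfunctions : (Carrier → Set ℓ) → (Fin n → Carrier) → Set (c ⊔ ℓ)
  LinCombOfEigenfunctions Allowed f =
    Σ ℕ λ m → Σ (Fin m → Carrier) λ λs → Σ (Fin m → Fin n → Carrier) λ g →
    Σ (Fin m → Carrier) λ coef →
      (∀ i → IsEigenfunction (λs i) (g i)) ×
      (∀ i → Allowed (λs i)) ×
      (∀ u → f u ≈ sumR R m (λ i → coef i * g i u))

-- A 2-partition (V₁,V₂) of Fin n, V₁ given by its indicator, V₂ its complement.
-- Both parts nonempty.
module _ {n : ℕ} (G : Graph n) where
  open Data.Bool using (not)

  IsTwoPartition : (Fin n → Bool) → Set
  IsTwoPartition V₁ = (∃ λ u → V₁ u ≡ true) × (∃ λ u → V₁ u ≡ false)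

  IsEquitable : (Fin n → Bool) → ℕ → ℕ → ℕ → ℕ → Set
  IsEquitable V₁ p11 p12 p21 p22 =
    IsTwoPartition V₁ ×
    (∀ u → V₁ u ≡ true  → nbrsIn G u V₁ ≡ p11 × nbrsIn G u (λ w → not (V₁ w)) ≡ p12) ×
    (∀ u → V₁ u ≡ false → nbrsIn G u V₁ ≡ p21 × nbrsIn G u (λ w → not (V₁ w)) ≡ p22)

module _ {c ℓ : Level} (R : RealField c ℓ) {n : ℕ} (G : Graph n) where
  open RealField R

  IsThetaEquitable : Carrier → (Fin n → Bool) → Set ℓ
  IsThetaEquitable θ V₁ = Σ ℕ λ p11 → Σ ℕ λ p12 → Σ ℕ λ p21 → Σ ℕ λ p22 →
    IsEquitable G V₁ p11 p12 p21 p22 × (θ ≈ fromℤ R (+ p11 ℤ.- + p21))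

-- Write A h for nbrSum h and let χ be the indicator of V₁. Equitability gives A χ = θ χ + p₂₁ 𝟙, and every eigenfunction g
-- with eigenvalue λ ≠ k is orthogonal to the k-eigenfunction 𝟙; hence
-- λ ⟨g, χ⟩ = ⟨g, A χ⟩ = θ ⟨g, χ⟩, so ⟨g, χ⟩ = 0 when also λ ≠ θ. Therefore f₁ ⊥ χ, and ⟨f₁, χ⟩ is
-- |Supp⁺(f₁) ∩ V₁| − |Supp⁻(f₁) ∩ V₁| computed in an ordered field, which has characteristic zero.
{-# OPTIONS --safe #-}
module Submission where

open import Defs
open import Level using (Level)
open import Function using (_∘_)
open import Data.Nat using (ℕ; zero; suc)
open import Data.Integer as ℤ using (ℤ; +_; -1ℤ; _≟_; _⊖_)
open import Data.Integer.Properties using ([1+m]⊖[1+n]≡m⊖n; m-n≡m⊖n)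
open import Data.Bool using (Bool; true; false; if_then_else_; _∧_)
open import Data.Fin as Fin using (Fin)
open import Data.Product using (_,_; proj₁; proj₂; _×_)
open import Data.Sum using (_⊎_; inj₁; inj₂)
open import Data.Empty using (⊥-elim)
open import Relation.Nullary using (¬_)
open import Relation.Nullary.Decidable using (⌊_⌋)
open import Relation.Binary.PropositionalEquality as ≡ using (_≡_)
open import Relation.Binary.Bundles using (Poset)
open import Relation.Binary.Structures using (IsTotalOrder)
import Relation.Binary.Reasoning.PartialOrder

module RealFieldProperties {c ℓ : Level} (R : RealField c ℓ) where
  open RealField R
  open import Algebra.Properties.Ring ring using (-1*x≈-x; [y-z]x≈yx-zx)
  open import Algebra.Properties.Group +-group using (x∙y⁻¹≈ε⇒x≈y; x≈y⇒x∙y⁻¹≈ε; ⁻¹-involutive; ∙-cancelˡ)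
  open import Algebra.Properties.CommutativeSemigroup +-commutativeSemigroup using (x∙yz≈y∙xz)
  open import Algebra.Properties.Semiring.Sum semiring using (sum; sum-syntax; sum-cong-≋; ∑-distrib-+)
  open IsTotalOrder isTotalOrder using (total; antisym; isPartialOrder)
    renaming (trans to ≤-trans; reflexive to ≤-reflexive)

  private
    ≤-poset : Poset c ℓ ℓ
    ≤-poset = record { isPartialOrder = isPartialOrder }

    module ≤-Reasoning = Relation.Binary.Reasoning.PartialOrder ≤-poset

  0≤1 : 0# ≤ 1#
  0≤1 with total 0# 1#
  ... | inj₁ 0≤1′ = 0≤1′
  ... | inj₂ 1≤0 = begin
    0#                ≤⟨ *-nonneg 0≤-1 0≤-1 ⟩
    - 1# * - 1#       ≈⟨ -1*x≈-x (- 1#) ⟩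
    - - 1#            ≈⟨ ⁻¹-involutive 1# ⟩
    1#                ∎
    where
    open ≤-Reasoning
    0≤-1 : 0# ≤ (- 1#)
    0≤-1 = begin
      0#        ≈⟨ -‿inverseʳ 1# ⟨
      1# - 1#   ≤⟨ +-mono-≤ (- 1#) 1≤0 ⟩
      0# - 1#   ≈⟨ +-identityˡ (- 1#) ⟩
      - 1#      ∎

  1≤fromℕ-suc : ∀ n → 1# ≤ fromℕ R (suc n)
  1≤fromℕ-suc zero = ≤-reflexive (sym (+-identityʳ 1#))
  1≤fromℕ-suc (suc n) = begin
    1#                    ≈⟨ +-identityˡ 1# ⟨
    0# + 1#               ≤⟨ +-mono-≤ 1# (≤-trans 0≤1 (1≤fromℕ-suc n)) ⟩
    fromℕ R (suc n) + 1#  ≈⟨ +-comm _ 1# ⟩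
    fromℕ R (suc (suc n)) ∎
    where open ≤-Reasoning

  fromℕ-suc≉0 : ∀ n → ¬ (fromℕ R (suc n) ≈ 0#)
  fromℕ-suc≉0 n eq = 0≉1 (antisym 0≤1 (≤-trans (1≤fromℕ-suc n) (≤-reflexive eq)))

  fromℕ-injective : ∀ {m n} → fromℕ R m ≈ fromℕ R n → m ≡ n
  fromℕ-injective {zero}  {zero}  _  = ≡.refl
  fromℕ-injective {zero}  {suc n} eq = ⊥-elim (fromℕ-suc≉0 n (sym eq))
  fromℕ-injective {suc m} {zero}  eq = ⊥-elim (fromℕ-suc≉0 m eq)
  fromℕ-injective {suc m} {suc n} eq = ≡.cong suc (fromℕ-injective (∙-cancelˡ 1# _ _ eq))

  open import Relation.Binary.Reasoning.Setoid setoid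

  a*x≈b*x⇒x≈0 : ∀ {a b x} → a * x ≈ b * x → ¬ (a ≈ b) → x ≈ 0#
  a*x≈b*x⇒x≈0 {a} {b} {x} ax≈bx a≉b with inverse (a - b) (a≉b ∘ x∙y⁻¹≈ε⇒x≈y a b)
  ... | y , [a-b]y≈1 = begin
    x                   ≈⟨ *-identityˡ x ⟨
    1# * x              ≈⟨ *-congʳ (trans (sym [a-b]y≈1) (*-comm _ y)) ⟩
    (y * (a - b)) * x   ≈⟨ *-assoc y _ x ⟩
    y * ((a - b) * x)   ≈⟨ *-congˡ ([y-z]x≈yx-zx x a b) ⟩
    y * (a * x - b * x) ≈⟨ *-congˡ (x≈y⇒x∙y⁻¹≈ε ax≈bx) ⟩
    y * 0#              ≈⟨ zeroʳ y ⟩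
    0#                  ∎

  fromℤ[m⊖n]+n≈m : ∀ m n → fromℤ R (m ⊖ n) + fromℕ R n ≈ fromℕ R m
  fromℤ[m⊖n]+n≈m zero    zero    = +-identityʳ 0#
  fromℤ[m⊖n]+n≈m zero    (suc n) = -‿inverseˡ (fromℕ R (suc n))
  fromℤ[m⊖n]+n≈m (suc m) zero    = +-identityʳ (fromℕ R (suc m))
  fromℤ[m⊖n]+n≈m (suc m) (suc n) = begin
    fromℤ R (suc m ⊖ suc n) + (1# + fromℕ R n) ≈⟨ x∙yz≈y∙xz _ 1# _ ⟩
    1# + (fromℤ R (suc m ⊖ suc n) + fromℕ R n) ≈⟨ +-congˡ (+-congʳ (reflexive (≡.cong (fromℤ R) ([1+m]⊖[1+n]≡m⊖n m n)))) ⟩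
    1# + (fromℤ R (m ⊖ n) + fromℕ R n)         ≈⟨ +-congˡ (fromℤ[m⊖n]+n≈m m n) ⟩
    1# + fromℕ R m                             ∎

  fromℤ[m-n]+n≈m : ∀ m n → fromℤ R (+ m ℤ.- + n) + fromℕ R n ≈ fromℕ R m
  fromℤ[m-n]+n≈m m n rewrite m-n≡m⊖n m n = fromℤ[m⊖n]+n≈m m n

  sumR≡sum : ∀ n (f : Fin n → Carrier) → sumR R n f ≡ sum f
  sumR≡sum zero    f = ≡.refl
  sumR≡sum (suc n) f = ≡.cong (λ s → f Fin.zero + s) (sumR≡sum n (f ∘ Fin.suc))

  𝟙 : Bool → Carrier
  𝟙 b = if b then 1# else 0#

  sum-𝟙 : ∀ n (p : Fin n → Bool) → ∑[ i < n ] 𝟙 (p i) ≈ fromℕ R (count n p)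
  sum-𝟙 zero    p = refl
  sum-𝟙 (suc n) p with p Fin.zero
  ... | true  = +-congˡ (sum-𝟙 n (p ∘ Fin.suc))
  ... | false = trans (+-identityˡ _) (sum-𝟙 n (p ∘ Fin.suc))

  Sign : ℤ → Set
  Sign z = z ≡ + 1 ⊎ z ≡ -1ℤ ⊎ z ≡ + 0

  𝟙-sign-split : ∀ b {z} → Sign z → 𝟙 (b ∧ ⌊ z ≟ + 1 ⌋) ≈ fromℤ R z * 𝟙 b + 𝟙 (b ∧ ⌊ z ≟ -1ℤ ⌋)
  𝟙-sign-split false {z} _ = sym (trans (+-identityʳ _) (zeroʳ (fromℤ R z)))
  𝟙-sign-split true (inj₁ ≡.refl) = begin
    1#                 ≈⟨ +-identityʳ 1# ⟨
    1# + 0#            ≈⟨ *-identityʳ _ ⟨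
    (1# + 0#) * 1#     ≈⟨ +-identityʳ _ ⟨
    (1# + 0#) * 1# + 0# ∎
  𝟙-sign-split true (inj₂ (inj₁ ≡.refl)) = begin
    0#                       ≈⟨ -‿inverseˡ (1# + 0#) ⟨
    - (1# + 0#) + (1# + 0#)  ≈⟨ +-cong (*-identityʳ _) (sym (+-identityʳ 1#)) ⟨
    - (1# + 0#) * 1# + 1#    ∎
  𝟙-sign-split true (inj₂ (inj₂ ≡.refl)) = sym (trans (+-identityʳ _) (zeroˡ 1#))

  count-signs : ∀ n (V : Fin n → Bool) (f : Fin n → ℤ) → (∀ u → Sign (f u)) →
    fromℕ R (count n (λ u → V u ∧ ⌊ f u ≟ + 1 ⌋)) ≈
    ∑[ u < n ] (fromℤ R (f u) * 𝟙 (V u)) + fromℕ R (count n (λ u → V u ∧ ⌊ f u ≟ -1ℤ ⌋))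
  count-signs n V f sign = begin
    fromℕ R (count n (λ u → V u ∧ ⌊ f u ≟ + 1 ⌋))
      ≈⟨ sum-𝟙 n _ ⟨
    ∑[ u < n ] 𝟙 (V u ∧ ⌊ f u ≟ + 1 ⌋)
      ≈⟨ sum-cong-≋ (λ u → 𝟙-sign-split (V u) (sign u)) ⟩
    ∑[ u < n ] (fromℤ R (f u) * 𝟙 (V u) + 𝟙 (V u ∧ ⌊ f u ≟ -1ℤ ⌋))
      ≈⟨ ∑-distrib-+ (λ u → fromℤ R (f u) * 𝟙 (V u)) (λ u → 𝟙 (V u ∧ ⌊ f u ≟ -1ℤ ⌋)) ⟩
    ∑[ u < n ] (fromℤ R (f u) * 𝟙 (V u)) + ∑[ u < n ] 𝟙 (V u ∧ ⌊ f u ≟ -1ℤ ⌋)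
      ≈⟨ +-congˡ (sum-𝟙 n _) ⟩
    ∑[ u < n ] (fromℤ R (f u) * 𝟙 (V u)) + fromℕ R (count n (λ u → V u ∧ ⌊ f u ≟ -1ℤ ⌋)) ∎

module GraphSpectrum {c ℓ : Level} (R : RealField c ℓ) {n : ℕ} (G : Graph n) where
  open RealField R
  open RealFieldProperties R
  open Graph G using (adj) renaming (sym to adj-sym)
  open import Algebra.Properties.Semiring.Sum semiring
    using (sum; sum-syntax; sum-cong-≋; sum-cong-≗; sum-replicate-zero; ∑-distrib-+; ∑-comm; *-distribˡ-sum; *-distribʳ-sum)
  open import Algebra.Properties.CommutativeSemigroup *-commutativeSemigroup using (x∙yz≈y∙xz)
  open import Relation.Binary.Reasoning.Setoid setoid

  ⟨_,_⟩ : (Fin n → Carrier) → (Fin n → Carrier) → Carrier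
  ⟨ f , g ⟩ = ∑[ u < n ] (f u * g u)

  ⟨⟩-comm : ∀ f g → ⟨ f , g ⟩ ≈ ⟨ g , f ⟩
  ⟨⟩-comm f g = sum-cong-≋ (λ u → *-comm (f u) (g u))

  ⟨⟩-congʳ : ∀ f {g h} → (∀ u → g u ≈ h u) → ⟨ f , g ⟩ ≈ ⟨ f , h ⟩
  ⟨⟩-congʳ f g≈h = sum-cong-≋ (λ u → *-congˡ (g≈h u))

  ⟨⟩-*ʳ : ∀ f g a → ⟨ f , (λ u → a * g u) ⟩ ≈ a * ⟨ f , g ⟩
  ⟨⟩-*ʳ f g a = trans (sum-cong-≋ (λ u → x∙yz≈y∙xz (f u) a (g u))) (sym (*-distribˡ-sum a (λ u → f u * g u)))

  ⟨⟩-+ʳ : ∀ f g h → ⟨ f , (λ u → g u + h u) ⟩ ≈ ⟨ f , g ⟩ + ⟨ f , h ⟩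
  ⟨⟩-+ʳ f g h = trans (sum-cong-≋ (λ u → distribˡ (f u) (g u) (h u))) (∑-distrib-+ (λ u → f u * g u) (λ u → f u * h u))

  onNbrs : (Fin n → Carrier) → Fin n → Fin n → Carrier
  onNbrs f u w = if adj u w then f w else 0#

  nbrSum≈∑ : ∀ f u → nbrSum R G f u ≈ sum (onNbrs f u)
  nbrSum≈∑ f u = reflexive (sumR≡sum n (onNbrs f u))

  onNbrs-*-swap : ∀ f g u w → onNbrs f u w * g u ≈ f w * onNbrs g w u
  onNbrs-*-swap f g u w rewrite adj-sym w u with adj u w
  ... | true  = refl
  ... | false = trans (zeroˡ (g u)) (sym (zeroʳ (f w)))

  nbrSum-selfAdjoint : ∀ f g → ⟨ nbrSum R G f , g ⟩ ≈ ⟨ f , nbrSum R G g ⟩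
  nbrSum-selfAdjoint f g = begin
    ∑[ u < n ] (nbrSum R G f u * g u)       ≈⟨ sum-cong-≋ (λ u → *-congʳ (nbrSum≈∑ f u)) ⟩
    ∑[ u < n ] (sum (onNbrs f u) * g u)     ≈⟨ sum-cong-≋ (λ u → *-distribʳ-sum (g u) (onNbrs f u)) ⟩
    ∑[ u < n ] ∑[ w < n ] (onNbrs f u w * g u) ≈⟨ ∑-comm (λ u w → onNbrs f u w * g u) ⟩
    ∑[ w < n ] ∑[ u < n ] (onNbrs f u w * g u) ≈⟨ sum-cong-≋ (λ w → sum-cong-≋ (λ u → onNbrs-*-swap f g u w)) ⟩
    ∑[ w < n ] ∑[ u < n ] (f w * onNbrs g w u) ≈⟨ sum-cong-≋ (λ w → *-distribˡ-sum (f w) (onNbrs g w)) ⟨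
    ∑[ w < n ] (f w * sum (onNbrs g w))     ≈⟨ sum-cong-≋ (λ w → *-congˡ (nbrSum≈∑ g w)) ⟨
    ∑[ w < n ] (f w * nbrSum R G g w)       ∎

  EigenEquation : Carrier → (Fin n → Carrier) → Set ℓ
  EigenEquation μ h = ∀ u → μ * h u ≈ nbrSum R G h u

  eigen-⟨,nbrSum⟩ : ∀ {μ g} → EigenEquation μ g → ∀ h → ⟨ g , nbrSum R G h ⟩ ≈ μ * ⟨ g , h ⟩
  eigen-⟨,nbrSum⟩ {μ} {g} g-eigen h = begin
    ⟨ g , nbrSum R G h ⟩     ≈⟨ nbrSum-selfAdjoint g h ⟨
    ⟨ nbrSum R G g , h ⟩     ≈⟨ ⟨⟩-comm (nbrSum R G g) h ⟩
    ⟨ h , nbrSum R G g ⟩     ≈⟨ ⟨⟩-congʳ h (λ u → sym (g-eigen u)) ⟩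
    ⟨ h , (λ u → μ * g u) ⟩  ≈⟨ ⟨⟩-*ʳ h g μ ⟩
    μ * ⟨ h , g ⟩            ≈⟨ *-congˡ (⟨⟩-comm h g) ⟩
    μ * ⟨ g , h ⟩            ∎

  eigenfunctions-orthogonal : ∀ {κ μ g h} → EigenEquation κ g → EigenEquation μ h → ¬ (κ ≈ μ) →
    ⟨ g , h ⟩ ≈ 0#
  eigenfunctions-orthogonal {κ} {μ} {g} {h} g-eigen h-eigen = a*x≈b*x⇒x≈0 (begin
    κ * ⟨ g , h ⟩            ≈⟨ eigen-⟨,nbrSum⟩ g-eigen h ⟨
    ⟨ g , nbrSum R G h ⟩     ≈⟨ ⟨⟩-congʳ g (λ u → sym (h-eigen u)) ⟩
    ⟨ g , (λ u → μ * h u) ⟩  ≈⟨ ⟨⟩-*ʳ g h μ ⟩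
    μ * ⟨ g , h ⟩            ∎)

  regular⇒eigen-const : ∀ {k} → Regular G k → EigenEquation (fromℕ R k) (λ _ → 1#)
  regular⇒eigen-const {k} regular u = begin
    fromℕ R k * 1#             ≈⟨ *-identityʳ (fromℕ R k) ⟩
    fromℕ R k                  ≡⟨ ≡.cong (fromℕ R) (regular u) ⟨
    fromℕ R (degree G u)       ≈⟨ sum-𝟙 n (adj u) ⟨
    sum (onNbrs (λ _ → 1#) u)  ≈⟨ nbrSum≈∑ (λ _ → 1#) u ⟨
    nbrSum R G (λ _ → 1#) u    ∎

  eigenfunction-orthogonal-modConstants : ∀ {k κ θ c g h} → Regular G k →
    EigenEquation κ g → ¬ (κ ≈ fromℕ R k) → ¬ (κ ≈ θ) →
    (∀ u → nbrSum R G h u ≈ θ * h u + c) → ⟨ g , h ⟩ ≈ 0#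
  eigenfunction-orthogonal-modConstants {k} {κ} {θ} {c} {g} {h} regular g-eigen κ≉k κ≉θ h-eigen =
    a*x≈b*x⇒x≈0 (begin
      κ * ⟨ g , h ⟩                               ≈⟨ eigen-⟨,nbrSum⟩ g-eigen h ⟨
      ⟨ g , nbrSum R G h ⟩                        ≈⟨ ⟨⟩-congʳ g h-eigen ⟩
      ⟨ g , (λ u → θ * h u + c) ⟩                 ≈⟨ ⟨⟩-+ʳ g (λ u → θ * h u) (λ _ → c) ⟩
      ⟨ g , (λ u → θ * h u) ⟩ + ⟨ g , (λ _ → c) ⟩ ≈⟨ +-cong (⟨⟩-*ʳ g h θ) (⟨⟩-congʳ g (λ _ → sym (*-identityʳ c))) ⟩
      θ * ⟨ g , h ⟩ + ⟨ g , (λ _ → c * 1#) ⟩      ≈⟨ +-congˡ (⟨⟩-*ʳ g (λ _ → 1#) c) ⟩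
      θ * ⟨ g , h ⟩ + c * ⟨ g , (λ _ → 1#) ⟩      ≈⟨ +-congˡ (*-congˡ g⊥const) ⟩
      θ * ⟨ g , h ⟩ + c * 0#                      ≈⟨ +-congˡ (zeroʳ c) ⟩
      θ * ⟨ g , h ⟩ + 0#                          ≈⟨ +-identityʳ _ ⟩
      θ * ⟨ g , h ⟩                               ∎) κ≉θ
    where
    g⊥const : ⟨ g , (λ _ → 1#) ⟩ ≈ 0#
    g⊥const = eigenfunctions-orthogonal g-eigen (regular⇒eigen-const regular) κ≉k

  linComb-orthogonal : ∀ {m f h} (coef : Fin m → Carrier) (g : Fin m → Fin n → Carrier) →
    (∀ u → f u ≈ sumR R m (λ i → coef i * g i u)) → (∀ i → ⟨ g i , h ⟩ ≈ 0#) → ⟨ f , h ⟩ ≈ 0#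
  linComb-orthogonal {m} {f} {h} coef g f≈ g⊥h = begin
    ∑[ u < n ] (f u * h u)
      ≈⟨ sum-cong-≋ (λ u → *-congʳ (trans (f≈ u) (reflexive (sumR≡sum m (λ i → coef i * g i u))))) ⟩
    ∑[ u < n ] (∑[ i < m ] (coef i * g i u) * h u)
      ≈⟨ sum-cong-≋ (λ u → *-distribʳ-sum (h u) (λ i → coef i * g i u)) ⟩
    ∑[ u < n ] ∑[ i < m ] (coef i * g i u * h u)
      ≈⟨ ∑-comm (λ u i → coef i * g i u * h u) ⟩
    ∑[ i < m ] ∑[ u < n ] (coef i * g i u * h u)
      ≈⟨ sum-cong-≋ (λ i → sum-cong-≋ (λ u → *-assoc (coef i) (g i u) (h u))) ⟩
    ∑[ i < m ] ∑[ u < n ] (coef i * (g i u * h u))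
      ≈⟨ sum-cong-≋ (λ i → *-distribˡ-sum (coef i) (λ u → g i u * h u)) ⟨
    ∑[ i < m ] (coef i * ⟨ g i , h ⟩)
      ≈⟨ sum-cong-≋ (λ i → trans (*-congˡ (g⊥h i)) (zeroʳ (coef i))) ⟩
    ∑[ i < m ] 0#
      ≈⟨ sum-replicate-zero m ⟩
    0# ∎

  nbrSum-𝟙 : ∀ V u → nbrSum R G (𝟙 ∘ V) u ≈ fromℕ R (nbrsIn G u V)
  nbrSum-𝟙 V u = begin
    nbrSum R G (𝟙 ∘ V) u                          ≈⟨ nbrSum≈∑ (𝟙 ∘ V) u ⟩
    sum (onNbrs (𝟙 ∘ V) u)                        ≡⟨ sum-cong-≗ (λ w → onNbrs-𝟙 (adj u w) (V w)) ⟩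
    ∑[ w < n ] 𝟙 (if adj u w then V w else false) ≈⟨ sum-𝟙 n (λ w → if adj u w then V w else false) ⟩
    fromℕ R (nbrsIn G u V)                        ∎
    where
    onNbrs-𝟙 : ∀ a b → (if a then 𝟙 b else 0#) ≡ 𝟙 (if a then b else false)
    onNbrs-𝟙 true  b = ≡.refl
    onNbrs-𝟙 false b = ≡.refl

  equitable⇒nbrSum-𝟙 : ∀ {θ V₁ p₁₁ p₂₁} →
    (∀ u → V₁ u ≡ true → nbrsIn G u V₁ ≡ p₁₁) → (∀ u → V₁ u ≡ false → nbrsIn G u V₁ ≡ p₂₁) →
    θ ≈ fromℤ R (+ p₁₁ ℤ.- + p₂₁) → ∀ u → nbrSum R G (𝟙 ∘ V₁) u ≈ θ * 𝟙 (V₁ u) + fromℕ R p₂₁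
  equitable⇒nbrSum-𝟙 {θ} {V₁} {p₁₁} {p₂₁} in-V₁ in-V₂ θ≈ u with V₁ u in u∈V₁
  ... | true = begin
    nbrSum R G (𝟙 ∘ V₁) u                   ≈⟨ nbrSum-𝟙 V₁ u ⟩
    fromℕ R (nbrsIn G u V₁)                 ≡⟨ ≡.cong (fromℕ R) (in-V₁ u u∈V₁) ⟩
    fromℕ R p₁₁                             ≈⟨ fromℤ[m-n]+n≈m p₁₁ p₂₁ ⟨
    fromℤ R (+ p₁₁ ℤ.- + p₂₁) + fromℕ R p₂₁ ≈⟨ +-congʳ (trans (sym θ≈) (sym (*-identityʳ θ))) ⟩
    θ * 1# + fromℕ R p₂₁                    ∎
  ... | false = begin
    nbrSum R G (𝟙 ∘ V₁) u                   ≈⟨ nbrSum-𝟙 V₁ u ⟩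
    fromℕ R (nbrsIn G u V₁)                 ≡⟨ ≡.cong (fromℕ R) (in-V₂ u u∈V₁) ⟩
    fromℕ R p₂₁                             ≈⟨ +-identityˡ (fromℕ R p₂₁) ⟨
    0# + fromℕ R p₂₁                        ≈⟨ +-congʳ (zeroʳ θ) ⟨
    θ * 0# + fromℕ R p₂₁                    ∎

proposition1p6 : ∀ {c ℓ} (R : RealField c ℓ) {n : ℕ} (G : Graph n) (k : ℕ) →
    Regular G k →
    (f₁ : Fin n → ℤ) → (∀ u → f₁ u ≡ + 1 ⊎ f₁ u ≡ -1ℤ ⊎ f₁ u ≡ + 0) →
    (θ : RealField.Carrier R) → IsNonPrincipalEigenvalue R G k θ →
    LinCombOfEigenfunctions R G
      (λ μ → ¬ (RealField._≈_ R μ (fromℕ R k)) × ¬ (RealField._≈_ R μ θ))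
      (λ u → fromℤ R (f₁ u)) →
    (V₁ : Fin n → Bool) → IsThetaEquitable R G θ V₁ →
    count n (λ u → V₁ u ∧ ⌊ f₁ u ≟ + 1 ⌋) ≡ count n (λ u → V₁ u ∧ ⌊ f₁ u ≟ -1ℤ ⌋)
proposition1p6 R {n} G k regular f₁ f₁-sign θ _ (m , _ , g , coef , g-eigen , g-allowed , f₁≈) V₁
  (p₁₁ , _ , p₂₁ , _ , (_ , V₁-nbrs , V₂-nbrs) , θ≈) =
  fromℕ-injective (begin
    fromℕ R (count n (λ u → V₁ u ∧ ⌊ f₁ u ≟ + 1 ⌋))                         ≈⟨ count-signs n V₁ f₁ f₁-sign ⟩
    ⟨ fromℤ R ∘ f₁ , 𝟙 ∘ V₁ ⟩ + fromℕ R (count n (λ u → V₁ u ∧ ⌊ f₁ u ≟ -1ℤ ⌋)) ≈⟨ +-congʳ f₁⊥V₁ ⟩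
    0# + fromℕ R (count n (λ u → V₁ u ∧ ⌊ f₁ u ≟ -1ℤ ⌋))                       ≈⟨ +-identityˡ _ ⟩
    fromℕ R (count n (λ u → V₁ u ∧ ⌊ f₁ u ≟ -1ℤ ⌋))                            ∎)
  where
  open RealField R
  open RealFieldProperties R
  open GraphSpectrum R G
  open import Relation.Binary.Reasoning.Setoid setoid

  V₁-affineEigen : ∀ u → nbrSum R G (𝟙 ∘ V₁) u ≈ θ * 𝟙 (V₁ u) + fromℕ R p₂₁
  V₁-affineEigen = equitable⇒nbrSum-𝟙 (λ u → proj₁ ∘ V₁-nbrs u) (λ u → proj₁ ∘ V₂-nbrs u) θ≈

  f₁⊥V₁ : ⟨ fromℤ R ∘ f₁ , 𝟙 ∘ V₁ ⟩ ≈ 0#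
  f₁⊥V₁ = linComb-orthogonal coef g f₁≈ (λ i →
    eigenfunction-orthogonal-modConstants regular (proj₂ (g-eigen i))
      (proj₁ (g-allowed i)) (proj₂ (g-allowed i)) V₁-affineEigen)
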